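{- Let $\diamond$ be one of the binary operations restrict, permit, nonsuperset, or nonsubset. Then there exist, for each positive integer $m$, a finite ground set $U_m$ with $|U_m|=O(m^2)$, a total order $<_m$ on $U_m$, and families $\mathcal{F}_m,\mathcal{G}_m$ of subsets of $U_m$ such that $Z_{<_m}(\mathcal{F}_m)+Z_{<_m}(\mathcal{G}_m)=O(m^4)$ and $Z_{<_m}(\mathcal{F}_m\diamond\mathcal{G}_m)=\Omega(2^{m}/\mathrm{poly}(m))$, i.e. $Z_{<_m}(\mathcal{F}_m\diamond\mathcal{G}_m)\ge 2^{m}/p(m)$ for some polynomial $p$ and all sufficiently large $m$.
   Context: A family of sets is a set of subsets of a finite ground set $U$. Restrict: $\{F\in\mathcal{F}\mid\exists G\in\mathcal{G}: G\subseteq F\}$. Permit: $\{F\in\mathcal{F}\mid\exists G\in\mathcal{G}: F\subseteq G\}$. Nonsuperset: $\{F\in\mathcal{F}\mid\forall G\in\mathcal{G}: G\not\subseteq F\}$. Nonsubset: $\{F\in\mathcal{F}\mid\forall G\in\mathcal{G}: F\not\subseteq G\}$ (each is an operation $\mathcal{F}\diamond\mathcal{G}$). A zero-suppressed binary decision diagram (ZDD) with respect to a total order $<$ on $U$ is a rooted DAG with two terminal nodes $\top,\bot$ and internal nodes $\mathtt{n}$, each with a label $\mathsf{lb}(\mathtt{n})\in U$ and children $\mathsf{lo}(\mathtt{n}),\mathsf{hi}(\mathtt{n})$, labels strictly increasing along arcs. A node represents: $\{\emptyset\}$ if $\top$, $\emptyset$ if $\bot$, and $\mathcal{F}_{\mathsf{lo}(\mathtt{n})}\cup\{\{\mathsf{lb}(\mathtt{n})\}\cup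 S\mid S\in\mathcal{F}_{\mathsf{hi}(\mathtt{n})}\}$ otherwise; the ZDD represents the family of its root. The reduced ZDD (obtained by merging nodes with identical label and children and deleting nodes whose hi-child is $\bot$) is the unique smallest ZDD for the family and order; $Z_<(\mathcal{F})$ is its number of nodes. Asymptotics are as $m\to\infty$. -}

module Defs where

open import Level using (0ℓ)
open import Data.Nat using (ℕ; suc; _+_)
open import Data.Fin using (Fin)
import Data.Fin as F
open import Data.Fin.Subset using (Subset; _⊆_; ⁅_⁆; _∪_) renaming (⊥ to ∅)
open import Data.Product using (Σ; _×_; ∃)
open import Relation.Nullary using (¬_)
open import Function.Bundles using (_⇔_)

-- Ground set U = Fin n, ordered by the natural order on Fin n.
-- A family of subsets of U is a predicate on subsets of U.
Family : ℕ → Set₁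
Family n = Subset n → Set

data Op : Set where
  restrict permit nonsuperset nonsubset : Op

apply : ∀ {n} → Op → Family n → Family n → Family n
apply restrict    F G S = F S × ∃ λ T → G T × (T ⊆ S)
apply permit      F G S = F S × ∃ λ T → G T × (S ⊆ T)
apply nonsuperset F G S = F S × (∀ T → G T → ¬ (T ⊆ S))
apply nonsubset   F G S = F S × (∀ T → G T → ¬ (S ⊆ T))

data Ref (k : ℕ) : Set where
  top bot : Ref k
  node    : Fin k → Ref k

LabelOK : ∀ {n k} → (Fin k → Fin n) → Fin n → Ref k → Set
LabelOK lb l top      = Data.Unit.⊤ where import Data.Unit
LabelOK lb l bot      = Data.Unit.⊤ where import Data.Unit
LabelOK lb l (node j) = l F.< lb j

record ZDD (n k : ℕ) : Set where
  field
    lb    : Fin k → Fin n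
    lo hi : Fin k → Ref k
    lo-ok : ∀ i → LabelOK lb (lb i) (lo i)
    hi-ok : ∀ i → LabelOK lb (lb i) (hi i)
    root  : Ref k

size : ∀ {n k} → ZDD n k → ℕ
size {k = k} _ = k + 2

data Mem {n k : ℕ} (Z : ZDD n k) : Ref k → Subset n → Set where
  mem-top : Mem Z top ∅
  mem-lo  : ∀ {i S} → Mem Z (ZDD.lo Z i) S → Mem Z (node i) S
  mem-hi  : ∀ {i S} → Mem Z (ZDD.hi Z i) S → Mem Z (node i) (⁅ ZDD.lb Z i ⁆ ∪ S)

Represents : ∀ {n k} → ZDD n k → Family n → Set
Represents Z F = ∀ S → Mem Z (ZDD.root Z) S ⇔ F S

-- "Z(F) ≤ b": some ZDD for F has at most b nodes (the reduced ZDD is the smallest)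
ZSize≤ : ∀ {n} → Family n → ℕ → Set
ZSize≤ {n} F b = Σ ℕ λ k → Σ (ZDD n k) λ Z → Represents Z F × (size Z Data.Nat.≤ b)

-- A ZDD representing H must send two prefixes x, x′ ∈ {0,1}^m (the decisions on the first m
-- elements) to different nodes as soon as some suffix y separates them, x ++ y ∈ H ∌ x′ ++ y:
-- the node reached by reading x represents the cofactor {y | x ++ y ∈ H}.  Order the ground set
-- as x₀ < … < x_{m-1} < y₀ < … < y_{m-1} and let F be the family of all subsets.  For restrict
-- and nonsuperset take G = {{xᵢ, yᵢ}}, for permit and nonsubset G = {(X ∖ {xᵢ}) ∪ {yᵢ}}; then
-- the suffix {yᵢ} separates any two prefixes that differ at xᵢ, so F ◇ G needs 2^m nodes, while
-- F and G have ZDDs with O(m) and O(m²) nodes.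

module Submission where

open import Defs
open import Data.Nat using (ℕ; zero; suc; _+_; _*_; _^_; _≤_; _<_; z≤n; s≤s)
import Data.Nat.Properties as ℕ
open import Data.Nat.Tactic.RingSolver using (solve-∀)
open import Data.Bool using (Bool; true; false)
import Data.Bool.Properties as Bool
open import Data.Fin using (Fin; toℕ; fromℕ; fromℕ<; inject₁; _↑ˡ_; _↑ʳ_; remQuot; combine)
import Data.Fin as Fin
import Data.Fin.Properties as Fin
open import Data.Fin.Relation.Unary.Top using (view; ‵fromℕ; ‵inject₁)
open import Data.Fin.Induction using (>-weakInduction)
open import Data.Fin.Subset
  using (Subset; _∈_; _∉_; _⊆_; ⁅_⁆; _∪_; ∁; _-_; _─_; ⊤) renaming (⊥ to ∅)
open import Data.Fin.Subset.Properties
  using ( ∉⊥; x∈p∪q⁻; x∈p∪q⁺; x∈⁅y⁆⇒x≡y; x∈⁅x⁆; x≢y⇒x∉⁅y⁆; x∈∁p⇒x∉p; x∉p⇒x∈∁p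
        ; ⊆-refl; ⊆-antisym; drop-∷-⊆; _∈?_; _⊆?_; Empty-unique; ∪-identityˡ; ∪-identityʳ
        ; p─⊥≡p)
open import Data.Vec using ([]; _∷_; here; there; lookup; _++_; _[_]≔_)
import Data.Vec.Properties as Vec
open import Data.Product using (Σ; ∃; _×_; _,_; proj₁; proj₂; uncurry)
open import Data.Sum using (_⊎_; inj₁; inj₂)
open import Data.Sum.Function.Propositional using (_⊎-↔_)
open import Data.Empty using () renaming (⊥ to Empty)
open import Data.Unit using (tt) renaming (⊤ to Unit)
open import Relation.Nullary using (¬_; yes; no; contradiction)
open import Relation.Nullary.Decidable using (_→-dec_)
open import Relation.Binary.PropositionalEquality
open import Relation.Binary.Structures using (IsEquivalence)
open import Function using (_∘_; id)
open import Function.Bundles using (_⇔_; mk⇔; Equivalence; _↔_; Inverse; Injection)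
open import Function.Definitions using (Injective)
open import Function.Properties.Equivalence using (⇔-isEquivalence)
open import Function.Properties.Inverse using (↔-refl; ↔-sym; ↔-trans; ↔⇒↣)

module ⇔ {ℓ} = IsEquivalence (⇔-isEquivalence {ℓ})

lookup⇒∈ : ∀ {n} {U V : Subset n} {a} → lookup U a ≡ lookup V a → a ∈ U → a ∈ V
lookup⇒∈ {V = V} {a} eq a∈U = Vec.lookup⇒[]= a V (trans (sym eq) (Vec.[]=⇒lookup a∈U))

subset-ext : ∀ {n} {U V : Subset n} → (∀ a → lookup U a ≡ lookup V a) → U ≡ V
subset-ext eq = ⊆-antisym (lookup⇒∈ (eq _)) (lookup⇒∈ (sym (eq _)))

[]≔false : ∀ {n} (S : Subset n) j → j ∉ S → S [ j ]≔ false ≡ S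
[]≔false S j j∉S with lookup S j in eq
... | false = trans (cong (S [ j ]≔_) (sym eq)) (Vec.[]≔-lookup S j)
... | true  = contradiction (Vec.lookup⇒[]= j S eq) j∉S

[]≔true : ∀ {n} (S : Subset n) j → S [ j ]≔ true ≡ ⁅ j ⁆ ∪ S
[]≔true (b ∷ S) Fin.zero    = cong (true ∷_) (sym (∪-identityˡ S))
[]≔true (b ∷ S) (Fin.suc j) = cong (b ∷_) ([]≔true S j)

[]≔false-⊆ : ∀ {n} (S : Subset n) j → S [ j ]≔ false ⊆ S
[]≔false-⊆ S j {a} a∈ with a Fin.≟ j
... | yes refl = contradiction (trans (sym (Vec.[]=⇒lookup a∈)) (Vec.lookup∘update a S false)) λ ()
... | no  a≢j  = lookup⇒∈ (Vec.lookup∘update′ a≢j S false) a∈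

∉[]≔false : ∀ {n} (S : Subset n) j → j ∉ S [ j ]≔ false
∉[]≔false S j j∈ = contradiction (trans (sym (Vec.[]=⇒lookup j∈)) (Vec.lookup∘update j S false)) λ ()

⁅x⁆∪-cancel : ∀ {n} {x : Fin n} {S T} → x ∉ S → x ∉ T → ⁅ x ⁆ ∪ S ≡ ⁅ x ⁆ ∪ T → S ≡ T
⁅x⁆∪-cancel x∉S x∉T eq = ⊆-antisym (half x∉S eq) (half x∉T (sym eq))
  where
  half : ∀ {x S T} → x ∉ S → ⁅ x ⁆ ∪ S ≡ ⁅ x ⁆ ∪ T → S ⊆ T
  half {x} {S} {T} x∉S eq a∈S with x∈p∪q⁻ ⁅ x ⁆ T (subst (_ ∈_) eq (x∈p∪q⁺ (inj₂ a∈S)))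
  ... | inj₁ a∈⁅x⁆ = contradiction (subst (_∈ S) (x∈⁅y⁆⇒x≡y x a∈⁅x⁆) a∈S) x∉S
  ... | inj₂ a∈T   = a∈T

⁅x⁆⊆ : ∀ {n} {x : Fin n} {p} → x ∈ p → ⁅ x ⁆ ⊆ p
⁅x⁆⊆ {x = x} {p} x∈p a∈⁅x⁆ = subst (_∈ p) (sym (x∈⁅y⁆⇒x≡y x a∈⁅x⁆)) x∈p

⁅x⁆⊆⁅y⁆⇒x≡y : ∀ {n} {x y : Fin n} → ⁅ x ⁆ ⊆ ⁅ y ⁆ → x ≡ y
⁅x⁆⊆⁅y⁆⇒x≡y {x = x} {y} ⊆′ = x∈⁅y⁆⇒x≡y y (⊆′ (x∈⁅x⁆ x))

⊈⇒∃∈∉ : ∀ {n} {p q : Subset n} → ¬ p ⊆ q → ∃ λ i → i ∈ p × i ∉ q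
⊈⇒∃∈∉ {n} {p} {q} p⊈q
  with Fin.¬∀⟶∃¬ n (λ i → i ∈ p → i ∈ q) (λ i → (i ∈? p) →-dec (i ∈? q)) (λ ⊆′ → p⊈q (⊆′ _))
... | i , ¬i∈p⇒i∈q with i ∈? p | i ∈? q
...   | yes i∈p | no  i∉q = i , i∈p , i∉q
...   | yes _   | yes i∈q = contradiction (λ _ → i∈q) ¬i∈p⇒i∈q
...   | no  i∉p | _       = contradiction (λ i∈p → contradiction i∈p i∉p) ¬i∈p⇒i∈q

≢⇒∃∈∉ : ∀ {n} {p q : Subset n} → p ≢ q → ∃ λ i → (i ∈ p × i ∉ q) ⊎ (i ∈ q × i ∉ p)
≢⇒∃∈∉ {p = p} {q} p≢q with p ⊆? q | q ⊆? p
... | yes p⊆q | yes q⊆p = contradiction (⊆-antisym p⊆q q⊆p) p≢q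
... | no  p⊈q | _       = let i , i∈p , i∉q = ⊈⇒∃∈∉ p⊈q in i , inj₁ (i∈p , i∉q)
... | yes _   | no  q⊈p = let i , i∈q , i∉p = ⊈⇒∃∈∉ q⊈p in i , inj₂ (i∈q , i∉p)

Above : ∀ {n} → ℕ → Subset n → Set
Above p S = ∀ {a} → a ∈ S → p ≤ toℕ a

above-suc : ∀ {n} {j : Fin n} {S} → Above (toℕ j) S → j ∉ S → Above (suc (toℕ j)) S
above-suc {S = S} S≥j j∉S a∈S = Fin.≤∧≢⇒< (S≥j a∈S) λ { refl → j∉S a∈S }

above-[]≔false : ∀ {n} {j : Fin n} {S} → Above (toℕ j) S → Above (suc (toℕ j)) (S [ j ]≔ false)
above-[]≔false {j = j} {S} S≥j = above-suc (S≥j ∘ []≔false-⊆ S j) (∉[]≔false S j)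

above-size : ∀ {n} {S : Subset n} → Above n S → S ≡ ∅
above-size S≥n = Empty-unique λ (a , a∈S) → ℕ.<⇒≱ (Fin.toℕ<n a) (S≥n a∈S)

∅++∅ : ∀ m {n} → ∅ {m} ++ ∅ {n} ≡ ∅
∅++∅ zero    = refl
∅++∅ (suc m) = cong (false ∷_) (∅++∅ m)

⁅↑ˡ⁆ : ∀ {m} n (i : Fin m) → ⁅ i ↑ˡ n ⁆ ≡ ⁅ i ⁆ ++ ∅ {n}
⁅↑ˡ⁆ {suc m} n Fin.zero    = cong (true ∷_) (sym (∅++∅ m))
⁅↑ˡ⁆         n (Fin.suc i) = cong (false ∷_) (⁅↑ˡ⁆ n i)

⁅↑ʳ⁆ : ∀ m {n} (j : Fin n) → ⁅ m ↑ʳ j ⁆ ≡ ∅ {m} ++ ⁅ j ⁆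
⁅↑ʳ⁆ zero    j = refl
⁅↑ʳ⁆ (suc m) j = cong (false ∷_) (⁅↑ʳ⁆ m j)

∪-++ : ∀ {m n} (u u′ : Subset m) (v v′ : Subset n) →
       (u ++ v) ∪ (u′ ++ v′) ≡ (u ∪ u′) ++ (v ∪ v′)
∪-++ u u′ v v′ = Vec.zipWith-++ _ u v u′ v′

⁅↑ˡ⁆∪++ : ∀ {m} n (i : Fin m) u (v : Subset n) → ⁅ i ↑ˡ n ⁆ ∪ (u ++ v) ≡ (⁅ i ⁆ ∪ u) ++ v
⁅↑ˡ⁆∪++ n i u v = begin
  ⁅ i ↑ˡ n ⁆ ∪ (u ++ v)       ≡⟨ cong (_∪ (u ++ v)) (⁅↑ˡ⁆ n i) ⟩
  (⁅ i ⁆ ++ ∅) ∪ (u ++ v)     ≡⟨ ∪-++ ⁅ i ⁆ u ∅ v ⟩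
  (⁅ i ⁆ ∪ u) ++ (∅ ∪ v)      ≡⟨ cong ((⁅ i ⁆ ∪ u) ++_) (∪-identityˡ v) ⟩
  (⁅ i ⁆ ∪ u) ++ v            ∎
  where open ≡-Reasoning

⁅↑ʳ⁆∪∅ : ∀ m {n} (j : Fin n) → ⁅ m ↑ʳ j ⁆ ∪ ∅ ≡ ∅ {m} ++ ⁅ j ⁆
⁅↑ʳ⁆∪∅ m j = trans (∪-identityʳ _) (⁅↑ʳ⁆ m j)

++-⊆⁺ : ∀ {m n} {u u′ : Subset m} {v v′ : Subset n} → u ⊆ u′ → v ⊆ v′ → u ++ v ⊆ u′ ++ v′
++-⊆⁺ {u = []}    {[]}    _    v⊆v′ a∈ = v⊆v′ a∈
++-⊆⁺ {u = _ ∷ _} {_ ∷ _} u⊆u′ _    here with u⊆u′ here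
... | here = here
++-⊆⁺ {u = _ ∷ _} {_ ∷ _} u⊆u′ v⊆v′ (there a∈) = there (++-⊆⁺ (drop-∷-⊆ u⊆u′) v⊆v′ a∈)

++-⊆⁻ˡ : ∀ {m n} {u u′ : Subset m} {v v′ : Subset n} → u ++ v ⊆ u′ ++ v′ → u ⊆ u′
++-⊆⁻ˡ {u = _ ∷ _} {_ ∷ _} ⊆′ here with ⊆′ here
... | here = here
++-⊆⁻ˡ {u = _ ∷ _} {_ ∷ _} ⊆′ (there a∈) = there (++-⊆⁻ˡ (drop-∷-⊆ ⊆′) a∈)

++-⊆⁻ʳ : ∀ {m n} {u u′ : Subset m} {v v′ : Subset n} → u ++ v ⊆ u′ ++ v′ → v ⊆ v′
++-⊆⁻ʳ {u = []}    {[]}    ⊆′ = ⊆′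
++-⊆⁻ʳ {u = _ ∷ _} {_ ∷ _} ⊆′ = ++-⊆⁻ʳ (drop-∷-⊆ ⊆′)

Up : ∀ {n} → Fin n → Subset n
Up Fin.zero    = ⊤
Up (Fin.suc j) = false ∷ Up j

Up-inject₁ : ∀ {n} (j : Fin n) → Up (inject₁ j) ≡ ⁅ inject₁ j ⁆ ∪ Up (Fin.suc j)
Up-inject₁ Fin.zero    = cong (true ∷_) (sym (∪-identityˡ ⊤))
Up-inject₁ (Fin.suc j) = cong (false ∷_) (Up-inject₁ j)

Up-fromℕ : ∀ n → Up (fromℕ n) ≡ ⁅ fromℕ n ⁆
Up-fromℕ zero    = refl
Up-fromℕ (suc n) = cong (false ∷_) (Up-fromℕ n)

Up-inject₁-self : ∀ {n} (j : Fin n) → Up (inject₁ j) - inject₁ j ≡ Up (Fin.suc j)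
Up-inject₁-self Fin.zero    = cong (false ∷_) (p─⊥≡p ⊤)
Up-inject₁-self (Fin.suc j) = cong (false ∷_) (Up-inject₁-self j)

Up-fromℕ-self : ∀ n → Up (fromℕ n) - fromℕ n ≡ ∅
Up-fromℕ-self zero    = refl
Up-fromℕ-self (suc n) = cong (false ∷_) (Up-fromℕ-self n)

Up-inject₁-other : ∀ {n} (j : Fin n) i → i ≢ inject₁ j →
                   ⁅ inject₁ j ⁆ ∪ (Up (Fin.suc j) - i) ≡ Up (inject₁ j) - i
Up-inject₁-other Fin.zero    Fin.zero    i≢j = contradiction refl i≢j
Up-inject₁-other Fin.zero    (Fin.suc i) _   = cong (true ∷_) (∪-identityˡ _)
Up-inject₁-other (Fin.suc j) Fin.zero    _   = cong (false ∷_) (begin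
  ⁅ inject₁ j ⁆ ∪ (Up (Fin.suc j) ─ ∅)   ≡⟨ cong (⁅ inject₁ j ⁆ ∪_) (p─⊥≡p (Up (Fin.suc j))) ⟩
  ⁅ inject₁ j ⁆ ∪ Up (Fin.suc j)         ≡⟨ Up-inject₁ j ⟨
  Up (inject₁ j)                         ≡⟨ p─⊥≡p (Up (inject₁ j)) ⟨
  Up (inject₁ j) ─ ∅                     ∎)
  where open ≡-Reasoning
Up-inject₁-other (Fin.suc j) (Fin.suc i) i≢j =
  cong (false ∷_) (Up-inject₁-other j i (i≢j ∘ cong Fin.suc))

⊤─p≡∁p : ∀ {n} (p : Subset n) → ⊤ ─ p ≡ ∁ p
⊤─p≡∁p []          = refl
⊤─p≡∁p (true ∷ p)  = cong (false ∷_) (⊤─p≡∁p p)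
⊤─p≡∁p (false ∷ p) = cong (true ∷_) (⊤─p≡∁p p)

inject₁<suc : ∀ {n} (j : Fin n) → inject₁ j Fin.< Fin.suc j
inject₁<suc j = s≤s (ℕ.≤-reflexive (Fin.toℕ-inject₁ j))

inject₁<⇒suc≤ : ∀ {n} {j : Fin n} {i : Fin (suc n)} → inject₁ j Fin.< i → Fin.suc j Fin.≤ i
inject₁<⇒suc≤ {j = j} {i} j<i = subst (λ x → suc x ≤ toℕ i) (Fin.toℕ-inject₁ j) j<i

suc≤⇒inject₁< : ∀ {n} {j : Fin n} {i : Fin (suc n)} → Fin.suc j Fin.≤ i → inject₁ j Fin.< i
suc≤⇒inject₁< {j = j} {i} sj≤i = ℕ.<-≤-trans (inject₁<suc j) sj≤i

↑ˡ-mono-< : ∀ {m} n {i j : Fin m} → i Fin.< j → i ↑ˡ n Fin.< j ↑ˡ n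
↑ˡ-mono-< n {i} {j} = subst₂ _<_ (sym (Fin.toℕ-↑ˡ i n)) (sym (Fin.toℕ-↑ˡ j n))

↑ˡ<↑ʳ : ∀ {m n} (i : Fin m) (j : Fin n) → i ↑ˡ n Fin.< m ↑ʳ j
↑ˡ<↑ʳ {m} {n} i j = subst₂ _<_ (sym (Fin.toℕ-↑ˡ i n)) (sym (Fin.toℕ-↑ʳ m j))
  (ℕ.<-≤-trans (Fin.toℕ<n i) (ℕ.m≤m+n m (toℕ j)))

-- The node after position i of a chain, or e when i is the last position.
following : ∀ {n} {A : Set} → (Fin (suc n) → A) → A → Fin (suc n) → A
following {zero}  f e Fin.zero    = e
following {suc n} f e Fin.zero    = f (Fin.suc Fin.zero)
following {suc n} f e (Fin.suc j) = following (f ∘ Fin.suc) e j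

following-fromℕ : ∀ {n} {A : Set} (f : Fin (suc n) → A) e → following f e (fromℕ n) ≡ e
following-fromℕ {zero}  f e = refl
following-fromℕ {suc n} f e = following-fromℕ (f ∘ Fin.suc) e

following-inject₁ : ∀ {n} {A : Set} (f : Fin (suc n) → A) e j →
                    following f e (inject₁ j) ≡ f (Fin.suc j)
following-inject₁ {suc n} f e Fin.zero    = refl
following-inject₁ {suc n} f e (Fin.suc j) = following-inject₁ (f ∘ Fin.suc) e j

following-elim : ∀ {n} {A : Set} (P : Fin (suc n) → A → Set)
                 (f : Fin (suc n) → Fin (suc n) → A) (e : Fin (suc n) → A) →
                 P (fromℕ n) (e (fromℕ n)) → (∀ j → P (inject₁ j) (f (inject₁ j) (Fin.suc j))) →
                 ∀ i → P i (following (f i) (e i) i)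
following-elim P f e P-last P-inner i with view i
... | ‵fromℕ     = subst (P _) (sym (following-fromℕ (f _) (e _))) P-last
... | ‵inject₁ j = subst (P _) (sym (following-inject₁ (f _) (e _) j)) (P-inner j)

-- Separated prefixes force large ZDDs

module Cofactors {n k : ℕ} (Z : ZDD n k) where
  open ZDD Z

  StartsFrom : ℕ → Ref k → Set
  StartsFrom p (node i) = p ≤ toℕ (lb i)
  StartsFrom p top      = Unit
  StartsFrom p bot      = Unit

  startsFrom-zero : ∀ r → StartsFrom 0 r
  startsFrom-zero (node i) = z≤n
  startsFrom-zero top      = tt
  startsFrom-zero bot      = tt

  startsFrom-≤ : ∀ {p q} r → p ≤ q → StartsFrom q r → StartsFrom p r
  startsFrom-≤ (node i) p≤q q≤l = ℕ.≤-trans p≤q q≤l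
  startsFrom-≤ top      _   _   = tt
  startsFrom-≤ bot      _   _   = tt

  startsFrom-child : ∀ {l} r → LabelOK lb l r → StartsFrom (suc (toℕ l)) r
  startsFrom-child (node j) l<l′ = l<l′
  startsFrom-child top      _    = tt
  startsFrom-child bot      _    = tt

  startsFrom-lo : ∀ i → StartsFrom (suc (toℕ (lb i))) (lo i)
  startsFrom-hi : ∀ i → StartsFrom (suc (toℕ (lb i))) (hi i)
  startsFrom-lo i = startsFrom-child (lo i) (lo-ok i)
  startsFrom-hi i = startsFrom-child (hi i) (hi-ok i)

  mem-above : ∀ {p r S} → StartsFrom p r → Mem Z r S → Above p S
  mem-above _ mem-top a∈∅ = contradiction a∈∅ ∉⊥
  mem-above p≤l (mem-lo {i} m) = mem-above (startsFrom-≤ (lo i) (ℕ.m≤n⇒m≤1+n p≤l) (startsFrom-lo i)) m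
  mem-above {p} p≤l (mem-hi {i} {S} m) a∈ with x∈p∪q⁻ ⁅ lb i ⁆ S a∈
  ... | inj₁ a∈⁅l⁆ = subst (λ a → p ≤ toℕ a) (sym (x∈⁅y⁆⇒x≡y _ a∈⁅l⁆)) p≤l
  ... | inj₂ a∈S   = mem-above (startsFrom-≤ (hi i) (ℕ.m≤n⇒m≤1+n p≤l) (startsFrom-hi i)) m a∈S

  mem-∉ : ∀ {j r S} → StartsFrom (suc (toℕ j)) r → Mem Z r S → j ∉ S
  mem-∉ {j} j<l m j∈S = ℕ.n≮n (toℕ j) (mem-above j<l m j∈S)

  skip take : Fin n → Ref k → Ref k
  skip j (node i) with lb i Fin.≟ j
  ... | yes _ = lo i
  ... | no  _ = node i
  skip j r = r
  take j (node i) with lb i Fin.≟ j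
  ... | yes _ = hi i
  ... | no  _ = bot
  take j _ = bot

  step : Fin n → Bool → Ref k → Ref k
  step j false = skip j
  step j true  = take j

  skip-startsFrom : ∀ {j} r → StartsFrom (toℕ j) r → StartsFrom (suc (toℕ j)) (skip j r)
  skip-startsFrom top _ = tt
  skip-startsFrom bot _ = tt
  skip-startsFrom {j} (node i) j≤l with lb i Fin.≟ j
  ... | yes refl = startsFrom-lo i
  ... | no  l≢j  = Fin.≤∧≢⇒< j≤l (l≢j ∘ sym)

  take-startsFrom : ∀ {j} r → StartsFrom (suc (toℕ j)) (take j r)
  take-startsFrom top = tt
  take-startsFrom bot = tt
  take-startsFrom {j} (node i) with lb i Fin.≟ j
  ... | yes refl = startsFrom-hi i
  ... | no  _    = tt

  step-startsFrom : ∀ {j} b r → StartsFrom (toℕ j) r → StartsFrom (suc (toℕ j)) (step j b r)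
  step-startsFrom false r j≤r = skip-startsFrom r j≤r
  step-startsFrom true  r _   = take-startsFrom r

  mem-skip : ∀ {j r S} → StartsFrom (toℕ j) r → j ∉ S → Mem Z (skip j r) S ⇔ Mem Z r S
  mem-skip {r = top} _ _ = ⇔.refl
  mem-skip {r = bot} _ _ = ⇔.refl
  mem-skip {j} {node i} {S} _ j∉S with lb i Fin.≟ j
  ... | no  _    = ⇔.refl
  ... | yes refl = mk⇔ mem-lo (from refl)
    where
    from : ∀ {X} → X ≡ S → Mem Z (node i) X → Mem Z (lo i) S
    from refl (mem-lo m) = m
    from X≡S  (mem-hi m) = contradiction (subst (lb i ∈_) X≡S (x∈p∪q⁺ (inj₁ (x∈⁅x⁆ (lb i))))) j∉S

  mem-take : ∀ {j r S} → StartsFrom (toℕ j) r → j ∉ S → Mem Z (take j r) S ⇔ Mem Z r (⁅ j ⁆ ∪ S)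
  mem-take {j} {top} _ _ =
    mk⇔ (λ ()) λ m → contradiction (x∈p∪q⁺ (inj₁ (x∈⁅x⁆ j))) (mem-∉ {r = top} tt m)
  mem-take {r = bot} _ _ = mk⇔ (λ ()) (λ ())
  mem-take {j} {node i} {S} j≤l j∉S with lb i Fin.≟ j
  ... | no l≢j   = mk⇔ (λ ()) λ m →
    contradiction (x∈p∪q⁺ (inj₁ (x∈⁅x⁆ j))) (mem-∉ {r = node i} (Fin.≤∧≢⇒< j≤l (l≢j ∘ sym)) m)
  ... | yes refl = mk⇔ mem-hi (from refl)
    where
    from : ∀ {X} → X ≡ ⁅ lb i ⁆ ∪ S → Mem Z (node i) X → Mem Z (hi i) S
    from X≡ (mem-lo m) = contradiction (subst (lb i ∈_) (sym X≡) (x∈p∪q⁺ (inj₁ (x∈⁅x⁆ (lb i)))))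
                                       (mem-∉ (startsFrom-lo i) m)
    from X≡ (mem-hi m) = subst (Mem Z (hi i)) (⁅x⁆∪-cancel (mem-∉ (startsFrom-hi i) m) j∉S X≡) m

  mem-step : ∀ {j r S} b → StartsFrom (toℕ j) r → j ∉ S →
             Mem Z (step j b r) S ⇔ Mem Z r (S [ j ]≔ b)
  mem-step {j} {r} {S} false j≤r j∉S =
    subst (λ X → Mem Z (skip j r) S ⇔ Mem Z r X) (sym ([]≔false S j j∉S)) (mem-skip j≤r j∉S)
  mem-step {j} {r} {S} true  j≤r j∉S =
    subst (λ X → Mem Z (take j r) S ⇔ Mem Z r X) (sym ([]≔true S j)) (mem-take j≤r j∉S)

  walk : Subset n → (p : ℕ) → p ≤ n → Ref k
  walk σ zero    _   = root
  walk σ (suc p) p<n = step j (lookup σ j) (walk σ p (ℕ.<⇒≤ p<n))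
    where j = fromℕ< p<n

  walk-startsFrom : ∀ σ p (p≤n : p ≤ n) → StartsFrom p (walk σ p p≤n)
  walk-startsFrom σ zero    _   = startsFrom-zero root
  walk-startsFrom σ (suc p) p<n =
    subst (λ q → StartsFrom (suc q) (walk σ (suc p) p<n)) (Fin.toℕ-fromℕ< p<n)
      (step-startsFrom (lookup σ j) w (subst (λ q → StartsFrom q w) (sym (Fin.toℕ-fromℕ< p<n)) w≥p))
    where
    j = fromℕ< p<n
    w = walk σ p (ℕ.<⇒≤ p<n)
    w≥p = walk-startsFrom σ p (ℕ.<⇒≤ p<n)

  mem-walk : ∀ σ p (p≤n : p ≤ n) {T U : Subset n} → Above p T →
             (∀ a → toℕ a < p → lookup U a ≡ lookup σ a) →
             (∀ a → p ≤ toℕ a → lookup U a ≡ lookup T a) →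
             Mem Z (walk σ p p≤n) T ⇔ Mem Z root U
  mem-walk σ zero _ {T} _ _ U≗T =
    subst (λ X → Mem Z root T ⇔ Mem Z root X) (subset-ext λ a → sym (U≗T a z≤n)) ⇔.refl
  mem-walk σ (suc p) p<n {T} {U} T≥ U≗σ U≗T =
    ⇔.trans (mem-step (lookup σ j) j≤w j∉T)
            (mem-walk σ p p≤n T′≥ (λ a a<p → U≗σ a (ℕ.m<n⇒m<1+n a<p)) U≗T′)
    where
    p≤n = ℕ.<⇒≤ p<n
    j = fromℕ< p<n
    j≡p : toℕ j ≡ p
    j≡p = Fin.toℕ-fromℕ< p<n
    T′ = T [ j ]≔ lookup σ j
    j≤w : StartsFrom (toℕ j) (walk σ p p≤n)
    j≤w = subst (λ q → StartsFrom q (walk σ p p≤n)) (sym j≡p) (walk-startsFrom σ p p≤n)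
    j∉T : j ∉ T
    j∉T j∈T = ℕ.n≮n p (subst (suc p ≤_) j≡p (T≥ j∈T))
    beyond : ∀ {a} → a ≢ j → p ≤ toℕ a → suc p ≤ toℕ a
    beyond a≢j p≤a = ℕ.≤∧≢⇒< p≤a λ p≡a → a≢j (Fin.toℕ-injective (trans (sym p≡a) (sym j≡p)))
    T′≥ : Above p T′
    T′≥ {a} a∈T′ with a Fin.≟ j
    ... | yes refl = ℕ.≤-reflexive (sym j≡p)
    ... | no  a≢j  = ℕ.<⇒≤ (T≥ (lookup⇒∈ (Vec.lookup∘update′ a≢j T _) a∈T′))
    U≗T′ : ∀ a → p ≤ toℕ a → lookup U a ≡ lookup T′ a
    U≗T′ a p≤a with a Fin.≟ j
    ... | yes refl = trans (U≗σ a (ℕ.≤-reflexive (cong suc j≡p))) (sym (Vec.lookup∘update a T _))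
    ... | no  a≢j  = trans (U≗T a (beyond a≢j p≤a)) (sym (Vec.lookup∘update′ a≢j T _))

subsets : ∀ p → Fin (2 ^ p) → Subset p
subsets zero    _ = []
subsets (suc p) i = Inverse.to Fin.2↔Bool b ∷ subsets p j
  where
  b = proj₁ (remQuot {2} (2 ^ p) i)
  j = proj₂ (remQuot {2} (2 ^ p) i)

subsets-injective : ∀ p → Injective _≡_ _≡_ (subsets p)
subsets-injective zero {Fin.zero} {Fin.zero} _ = refl
subsets-injective (suc p) {i} {j} eq = begin
  i                                  ≡⟨ Fin.combine-remQuot {2} (2 ^ p) i ⟨
  uncurry combine (remQuot (2 ^ p) i) ≡⟨ cong (uncurry combine) (cong₂ _,_ heads tails) ⟩
  uncurry combine (remQuot (2 ^ p) j) ≡⟨ Fin.combine-remQuot {2} (2 ^ p) j ⟩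
  j                                  ∎
  where
  open ≡-Reasoning
  heads = Injection.injective (↔⇒↣ Fin.2↔Bool) (Vec.∷-injectiveˡ eq)
  tails = subsets-injective p (Vec.∷-injectiveʳ eq)

refIndex : ∀ {k} → Ref k → Fin (2 + k)
refIndex top      = Fin.zero
refIndex bot      = Fin.suc Fin.zero
refIndex (node i) = Fin.suc (Fin.suc i)

refIndex-injective : ∀ {k} → Injective _≡_ _≡_ (refIndex {k})
refIndex-injective {x = top}    {top}    _    = refl
refIndex-injective {x = bot}    {bot}    _    = refl
refIndex-injective {x = node i} {node j} refl = refl
refIndex-injective {x = top}    {bot}    ()
refIndex-injective {x = top}    {node _} ()
refIndex-injective {x = bot}    {top}    ()
refIndex-injective {x = bot}    {node _} ()
refIndex-injective {x = node _} {top}    ()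
refIndex-injective {x = node _} {bot}    ()

Separating : ∀ {p q} → Family (p + q) → Set
Separating {p} {q} H =
  ∀ {x x′ : Subset p} → x ≢ x′ → ∃ λ (y : Subset q) → ¬ (H (x ++ y) ⇔ H (x′ ++ y))

module _ {p q k} (Z : ZDD (p + q) k) {H : Family (p + q)} (Z-H : Represents Z H) where
  open Cofactors Z

  cofactorNode : Subset p → Ref k
  cofactorNode x = walk (x ++ ∅) p (ℕ.m≤m+n p q)

  cofactorNode-mem : ∀ x y → Mem Z (cofactorNode x) (∅ ++ y) ⇔ H (x ++ y)
  cofactorNode-mem x y =
    ⇔.trans (mem-walk (x ++ ∅) p (ℕ.m≤m+n p q) above agree-x agree-y) (Z-H (x ++ y))
    where
    above : Above p (∅ {p} ++ y)
    above {a} a∈ = ℕ.≮⇒≥ λ a<p → contradiction (begin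
      true                       ≡⟨ Vec.[]=⇒lookup a∈ ⟨
      lookup (∅ ++ y) a          ≡⟨ Vec.lookup-++-< ∅ y a a<p ⟩
      lookup ∅ (fromℕ< a<p)      ≡⟨ Vec.lookup-replicate (fromℕ< a<p) false ⟩
      false                      ∎) λ ()
      where open ≡-Reasoning
    agree-x : ∀ a → toℕ a < p → lookup (x ++ y) a ≡ lookup (x ++ ∅) a
    agree-x a a<p = trans (Vec.lookup-++-< x y a a<p) (sym (Vec.lookup-++-< x ∅ a a<p))
    agree-y : ∀ a → p ≤ toℕ a → lookup (x ++ y) a ≡ lookup (∅ ++ y) a
    agree-y a p≤a = trans (Vec.lookup-++-≥ x y a p≤a) (sym (Vec.lookup-++-≥ ∅ y a p≤a))

  cofactorNode-injective : Separating H → Injective _≡_ _≡_ cofactorNode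
  cofactorNode-injective sep {x} {x′} eq with Vec.≡-dec Bool._≟_ x x′
  ... | yes x≡x′ = x≡x′
  ... | no  x≢x′ = contradiction H⇔H′ ¬H⇔H′
    where
    y = proj₁ (sep x≢x′)
    ¬H⇔H′ = proj₂ (sep x≢x′)
    H⇔H′ : H (x ++ y) ⇔ H (x′ ++ y)
    H⇔H′ = ⇔.trans (⇔.sym (cofactorNode-mem x y))
             (subst (λ r → Mem Z r (∅ ++ y) ⇔ H (x′ ++ y)) (sym eq) (cofactorNode-mem x′ y))

  separating⇒2^p≤size : Separating H → 2 ^ p ≤ size Z
  separating⇒2^p≤size sep = subst (2 ^ p ≤_) (ℕ.+-comm 2 k) (Fin.injective⇒≤ index-injective)
    where
    index-injective : Injective _≡_ _≡_ (refIndex ∘ cofactorNode ∘ subsets p)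
    index-injective = subsets-injective p ∘ cofactorNode-injective sep ∘ refIndex-injective

-- Naming the nodes by an arbitrary type lets concrete ZDDs be written by pattern matching;
-- `compile` renumbers them along N ↔ Fin k.
data Ref′ (N : Set) : Set where
  top bot : Ref′ N
  node    : N → Ref′ N

LabelOK′ : ∀ {n} {N : Set} → (N → Fin n) → Fin n → Ref′ N → Set
LabelOK′ label l (node v) = l Fin.< label v
LabelOK′ label l top      = Unit
LabelOK′ label l bot      = Unit

record Diagram (n : ℕ) (N : Set) : Set where
  field
    label : N → Fin n
    lo hi : N → Ref′ N
    lo-ok : ∀ v → LabelOK′ label (label v) (lo v)
    hi-ok : ∀ v → LabelOK′ label (label v) (hi v)
    root  : Ref′ N

open Diagram

data Accepts {n} {N : Set} (D : Diagram n N) : Ref′ N → Subset n → Set where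
  acc-top : Accepts D top ∅
  acc-lo  : ∀ {v S} → Accepts D (lo D v) S → Accepts D (node v) S
  acc-hi  : ∀ {v S} → Accepts D (hi D v) S → Accepts D (node v) (⁅ label D v ⁆ ∪ S)

shannon : ∀ {n} {N : Set} (D : Diagram n N) v {S} →
          (label D v ∉ S → Accepts D (lo D v) S) →
          (label D v ∈ S → Accepts D (hi D v) (S [ label D v ]≔ false)) →
          Accepts D (node v) S
shannon D v {S} lo-case hi-case with label D v ∈? S
... | no  l∉S = acc-lo (lo-case l∉S)
... | yes l∈S = subst (Accepts D (node v)) S≡ (acc-hi (hi-case l∈S))
  where
  l = label D v
  S≡ : ⁅ l ⁆ ∪ (S [ l ]≔ false) ≡ S
  S≡ = begin
    ⁅ l ⁆ ∪ (S [ l ]≔ false)       ≡⟨ []≔true (S [ l ]≔ false) l ⟨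
    (S [ l ]≔ false) [ l ]≔ true   ≡⟨ Vec.[]≔-idempotent S l ⟩
    S [ l ]≔ true                  ≡⟨ cong (S [ l ]≔_) (Vec.[]=⇒lookup l∈S) ⟨
    S [ l ]≔ lookup S l            ≡⟨ Vec.[]≔-lookup S l ⟩
    S                              ∎
    where open ≡-Reasoning

module Compile {n k} {N : Set} (N↔k : N ↔ Fin k) (D : Diagram n N) where
  open Inverse N↔k using (to; from; strictlyInverseʳ)

  ref : Ref′ N → Ref k
  ref top      = top
  ref bot      = bot
  ref (node v) = node (to v)

  unref : Ref k → Ref′ N
  unref top      = top
  unref bot      = bot
  unref (node i) = node (from i)

  unref-ref : ∀ r → unref (ref r) ≡ r
  unref-ref top      = refl
  unref-ref bot      = refl
  unref-ref (node v) = cong node (strictlyInverseʳ v)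

  compile : ZDD n k
  compile = record
    { lb    = label D ∘ from
    ; lo    = ref ∘ lo D ∘ from
    ; hi    = ref ∘ hi D ∘ from
    ; lo-ok = λ i → ref-ok (lo D (from i)) (lo-ok D (from i))
    ; hi-ok = λ i → ref-ok (hi D (from i)) (hi-ok D (from i))
    ; root  = ref (root D)
    }
    where
    ref-ok : ∀ {l} r → LabelOK′ (label D) l r → LabelOK (label D ∘ from) l (ref r)
    ref-ok top      _   = tt
    ref-ok bot      _   = tt
    ref-ok (node v) l<v = subst (λ w → _ Fin.< label D w) (sym (strictlyInverseʳ v)) l<v

  sound : ∀ {r S} → Mem compile r S → Accepts D (unref r) S
  sound mem-top            = acc-top
  sound (mem-lo {i} {S} m) = acc-lo (subst (λ r → Accepts D r S) (unref-ref (lo D (from i))) (sound m))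
  sound (mem-hi {i} {S} m) = acc-hi (subst (λ r → Accepts D r S) (unref-ref (hi D (from i))) (sound m))

  complete : ∀ {r S} → Accepts D r S → Mem compile (ref r) S
  complete acc-top            = mem-top
  complete (acc-lo {v} {S} a) =
    mem-lo (subst (λ w → Mem compile (ref (lo D w)) S) (sym (strictlyInverseʳ v)) (complete a))
  complete (acc-hi {v} {S} a) =
    subst (λ w → Mem compile (node (to v)) (⁅ label D w ⁆ ∪ S)) (strictlyInverseʳ v)
      (mem-hi (subst (λ w → Mem compile (ref (hi D w)) S) (sym (strictlyInverseʳ v)) (complete a)))

  compile-represents : Represents compile (Accepts D (root D))
  compile-represents S =
    mk⇔ (λ m → subst (λ r → Accepts D r S) (unref-ref (root D)) (sound m)) complete

diagram-zsize : ∀ {n k} {N : Set} {G : Family n} → N ↔ Fin k → (D : Diagram n N) →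
                (∀ S → Accepts D (root D) S ⇔ G S) → ZSize≤ G (k + 2)
diagram-zsize N↔k D D⇔G = _ , compile , (λ S → ⇔.trans (compile-represents S) (D⇔G S)) , ℕ.≤-refl
  where open Compile N↔k D

zsize-weaken : ∀ {n} {F : Family n} {a b} → ZSize≤ F a → a ≤ b → ZSize≤ F b
zsize-weaken (k , Z , Z-F , size≤a) a≤b = k , Z , Z-F , ℕ.≤-trans size≤a a≤b

-- The families and their diagrams

Everything : ∀ {n} → Family n
Everything _ = Unit

module EverythingDiagram (n : ℕ) where
  next : Fin (suc n) → Ref′ (Fin (suc n))
  next = following node top

  diagram : Diagram (suc n) (Fin (suc n))
  diagram = record
    { label = id ; lo = next ; hi = next ; lo-ok = next-ok ; hi-ok = next-ok ; root = node Fin.zero }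
    where
    next-ok : ∀ v → LabelOK′ id v (next v)
    next-ok = following-elim (λ v r → LabelOK′ id v r) (λ _ → node) (λ _ → top) tt inject₁<suc

  accepts-via-next : ∀ v → (∀ T → Above (suc (toℕ v)) T → Accepts diagram (next v) T) →
                     ∀ S → Above (toℕ v) S → Accepts diagram (node v) S
  accepts-via-next v next-accepts S S≥v =
    shannon diagram v (λ v∉S → next-accepts S (above-suc S≥v v∉S))
                      (λ _ → next-accepts _ (above-[]≔false S≥v))

  accepts : ∀ v S → Above (toℕ v) S → Accepts diagram (node v) S
  accepts = >-weakInduction (λ v → ∀ S → Above (toℕ v) S → Accepts diagram (node v) S)
    (accepts-via-next (fromℕ n) λ T T≥ →
      subst₂ (Accepts diagram) (sym (following-fromℕ node top))
        (sym (above-size (subst (λ x → Above (suc x) T) (Fin.toℕ-fromℕ n) T≥))) acc-top)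
    (λ j IH → accepts-via-next (inject₁ j) λ T T≥ →
      subst (λ r → Accepts diagram r T) (sym (following-inject₁ node top j))
        (IH T (subst (λ x → Above (suc x) T) (Fin.toℕ-inject₁ j) T≥)))

everything-zsize : ∀ n → ZSize≤ (Everything {suc n}) (suc n + 2)
everything-zsize n =
  diagram-zsize ↔-refl diagram λ S → mk⇔ (λ _ → tt) (λ _ → accepts Fin.zero S (λ _ → z≤n))
  where open EverythingDiagram n

Pairs : ∀ m → Family (m + m)
Pairs m S = ∃ λ (i : Fin m) → S ≡ ⁅ i ⁆ ++ ⁅ i ⁆

module PairsDiagram (m : ℕ) where
  M = suc m

  pattern seek j = inj₁ j
  pattern mark j = inj₂ j

  label′ : Fin M ⊎ Fin M → Fin (M + M)
  label′ (seek j) = j ↑ˡ M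
  label′ (mark j) = M ↑ʳ j

  lo′ hi′ : Fin M ⊎ Fin M → Ref′ (Fin M ⊎ Fin M)
  lo′ (seek j) = following (λ j → node (seek j)) bot j
  lo′ (mark j) = bot
  hi′ (seek j) = node (mark j)
  hi′ (mark j) = top

  lo-ok′ : ∀ v → LabelOK′ label′ (label′ v) (lo′ v)
  lo-ok′ (seek j) =
    following-elim (λ i r → LabelOK′ label′ (i ↑ˡ M) r) (λ _ i → node (seek i)) (λ _ → bot)
      tt (λ j → ↑ˡ-mono-< M (inject₁<suc j)) j
  lo-ok′ (mark j) = tt

  hi-ok′ : ∀ v → LabelOK′ label′ (label′ v) (hi′ v)
  hi-ok′ (seek j) = ↑ˡ<↑ʳ j j
  hi-ok′ (mark j) = tt

  diagram : Diagram (M + M) (Fin M ⊎ Fin M)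
  diagram = record
    { label = label′ ; lo = lo′ ; hi = hi′ ; lo-ok = lo-ok′ ; hi-ok = hi-ok′
    ; root  = node (seek Fin.zero)
    }

  Spec : Ref′ (Fin M ⊎ Fin M) → Subset (M + M) → Set
  Spec (node (seek j)) S = ∃ λ (i : Fin M) → j Fin.≤ i × S ≡ ⁅ i ⁆ ++ ⁅ i ⁆
  Spec (node (mark j)) S = S ≡ ∅ {M} ++ ⁅ j ⁆
  Spec top             S = S ≡ ∅
  Spec bot             S = Empty

  pair-step : ∀ i → ⁅ i ↑ˡ M ⁆ ∪ (∅ {M} ++ ⁅ i ⁆) ≡ ⁅ i ⁆ ++ ⁅ i ⁆
  pair-step i = trans (⁅↑ˡ⁆∪++ M i (∅ {M}) ⁅ i ⁆) (cong (_++ ⁅ i ⁆) (∪-identityʳ ⁅ i ⁆))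

  sound : ∀ {r S} → Accepts diagram r S → Spec r S
  sound acc-top                 = refl
  sound (acc-lo {seek j} {S} a) =
    following-elim (λ i r → Spec r S → Spec (node (seek i)) S) (λ _ i → node (seek i)) (λ _ → bot)
      (λ ()) (λ j′ (i , sj′≤i , S≡) → i , ℕ.<⇒≤ (suc≤⇒inject₁< sj′≤i) , S≡) j (sound a)
  sound (acc-lo {mark j} ())
  sound (acc-hi {seek j} a) rewrite sound a = j , Fin.≤-refl , pair-step j
  sound (acc-hi {mark j} a) rewrite sound a = ⁅↑ʳ⁆∪∅ M j

  pair-at : ∀ i → Accepts diagram (node (seek i)) (⁅ i ⁆ ++ ⁅ i ⁆)
  pair-at i = subst (Accepts diagram (node (seek i))) (pair-step i)
    (acc-hi (subst (Accepts diagram (node (mark i))) (⁅↑ʳ⁆∪∅ M i) (acc-hi acc-top)))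

  seek-accepts : ∀ i j → j Fin.≤ i → Accepts diagram (node (seek j)) (⁅ i ⁆ ++ ⁅ i ⁆)
  seek-accepts i = >-weakInduction P
    (λ m≤i → subst (λ j → Accepts diagram (node (seek j)) (⁅ i ⁆ ++ ⁅ i ⁆))
                   (Fin.≤-antisym (Fin.≤fromℕ i) m≤i) (pair-at i))
    step
    where
    P : Fin M → Set
    P j = j Fin.≤ i → Accepts diagram (node (seek j)) (⁅ i ⁆ ++ ⁅ i ⁆)
    step : ∀ j → P (Fin.suc j) → P (inject₁ j)
    step j IH j≤i with inject₁ j Fin.≟ i
    ... | yes refl = pair-at _
    ... | no  j≢i  = acc-lo (subst (λ r → Accepts diagram r (⁅ i ⁆ ++ ⁅ i ⁆))
                                  (sym (following-inject₁ (λ j → node (seek j)) bot j))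
                                  (IH (inject₁<⇒suc≤ (Fin.≤∧≢⇒< j≤i j≢i))))

pairs-zsize : ∀ m → ZSize≤ (Pairs (suc m)) (suc m + suc m + 2)
pairs-zsize m = diagram-zsize (↔-sym Fin.+↔⊎) diagram λ S →
  mk⇔ (λ a → root-sound (sound a))
      (λ (i , S≡) → subst (Accepts diagram _) (sym S≡) (seek-accepts i Fin.zero z≤n))
  where
  open PairsDiagram m
  root-sound : ∀ {S} → Spec (node (seek Fin.zero)) S → Pairs (suc m) S
  root-sound (i , _ , S≡) = i , S≡

CoPairs : ∀ m → Family (m + m)
CoPairs m S = ∃ λ (i : Fin m) → S ≡ ∁ ⁅ i ⁆ ++ ⁅ i ⁆

module CoPairsDiagram (m : ℕ) where
  M = suc m
  Node = Fin M ⊎ ((Fin M × Fin M) ⊎ Fin M)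

  pattern choose j = inj₁ j
  pattern fill i p = inj₂ (inj₁ (i , p))
  pattern mark i   = inj₂ (inj₂ i)

  label′ : Node → Fin (M + M)
  label′ (choose j) = j ↑ˡ M
  label′ (fill i p) = p ↑ˡ M
  label′ (mark i)   = M ↑ʳ i

  lo′ hi′ : Node → Ref′ Node
  lo′ (choose j) = following (λ p → node (fill j p)) (node (mark j)) j
  lo′ (fill i p) = bot
  lo′ (mark i)   = bot
  hi′ (choose j) = following (λ j → node (choose j)) bot j
  hi′ (fill i p) = following (λ p → node (fill i p)) (node (mark i)) p
  hi′ (mark i)   = top

  lo-ok′ : ∀ v → LabelOK′ label′ (label′ v) (lo′ v)
  lo-ok′ (choose j) =
    following-elim (λ q r → LabelOK′ label′ (q ↑ˡ M) r) (λ j p → node (fill j p)) (λ j → node (mark j))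
      (↑ˡ<↑ʳ (fromℕ m) _) (λ q → ↑ˡ-mono-< M (inject₁<suc q)) j
  lo-ok′ (fill i p) = tt
  lo-ok′ (mark i)   = tt

  hi-ok′ : ∀ v → LabelOK′ label′ (label′ v) (hi′ v)
  hi-ok′ (choose j) =
    following-elim (λ q r → LabelOK′ label′ (q ↑ˡ M) r) (λ _ j → node (choose j)) (λ _ → bot)
      tt (λ q → ↑ˡ-mono-< M (inject₁<suc q)) j
  hi-ok′ (fill i p) =
    following-elim (λ q r → LabelOK′ label′ (q ↑ˡ M) r) (λ _ p → node (fill i p)) (λ _ → node (mark i))
      (↑ˡ<↑ʳ (fromℕ m) i) (λ q → ↑ˡ-mono-< M (inject₁<suc q)) p
  hi-ok′ (mark i)   = tt

  diagram : Diagram (M + M) Node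
  diagram = record
    { label = label′ ; lo = lo′ ; hi = hi′ ; lo-ok = lo-ok′ ; hi-ok = hi-ok′
    ; root  = node (choose Fin.zero)
    }

  Spec : Ref′ Node → Subset (M + M) → Set
  Spec (node (choose j)) S = ∃ λ (i : Fin M) → j Fin.≤ i × S ≡ (Up j - i) ++ ⁅ i ⁆
  Spec (node (fill i p)) S = S ≡ Up p ++ ⁅ i ⁆
  Spec (node (mark i))   S = S ≡ ∅ {M} ++ ⁅ i ⁆
  Spec top               S = S ≡ ∅
  Spec bot               S = Empty

  fill-last-step : ∀ (i : Fin M) → ⁅ fromℕ m ↑ˡ M ⁆ ∪ (∅ {M} ++ ⁅ i ⁆) ≡ Up (fromℕ m) ++ ⁅ i ⁆
  fill-last-step i = trans (⁅↑ˡ⁆∪++ M (fromℕ m) (∅ {M}) ⁅ i ⁆)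
                           (cong (_++ ⁅ i ⁆) (trans (∪-identityʳ _) (sym (Up-fromℕ m))))

  fill-step : ∀ (i : Fin M) (q : Fin m) →
              ⁅ inject₁ q ↑ˡ M ⁆ ∪ (Up (Fin.suc q) ++ ⁅ i ⁆) ≡ Up (inject₁ q) ++ ⁅ i ⁆
  fill-step i q = trans (⁅↑ˡ⁆∪++ M (inject₁ q) _ ⁅ i ⁆) (cong (_++ ⁅ i ⁆) (sym (Up-inject₁ q)))

  choose-step : ∀ (i : Fin M) (q : Fin m) → i ≢ inject₁ q →
                ⁅ inject₁ q ↑ˡ M ⁆ ∪ ((Up (Fin.suc q) - i) ++ ⁅ i ⁆) ≡ (Up (inject₁ q) - i) ++ ⁅ i ⁆
  choose-step i q i≢q =
    trans (⁅↑ˡ⁆∪++ M (inject₁ q) _ ⁅ i ⁆) (cong (_++ ⁅ i ⁆) (Up-inject₁-other q i i≢q))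

  sound : ∀ {r S} → Accepts diagram r S → Spec r S
  sound acc-top = refl
  sound (acc-lo {choose j} {S} a) =
    following-elim (λ q r → Spec r S → Spec (node (choose q)) S)
      (λ j p → node (fill j p)) (λ j → node (mark j))
      (λ S≡ → fromℕ m , Fin.≤-refl , trans S≡ (cong (_++ ⁅ fromℕ m ⁆) (sym (Up-fromℕ-self m))))
      (λ q S≡ → inject₁ q , Fin.≤-refl , trans S≡ (cong (_++ ⁅ inject₁ q ⁆) (sym (Up-inject₁-self q))))
      j (sound a)
  sound (acc-lo {fill i p} ())
  sound (acc-lo {mark i} ())
  sound (acc-hi {choose j} {S} a) =
    following-elim (λ q r → Spec r S → Spec (node (choose q)) (⁅ q ↑ˡ M ⁆ ∪ S))
      (λ _ j → node (choose j)) (λ _ → bot)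
      (λ ())
      (λ q (i , sq≤i , S≡) → let q<i = suc≤⇒inject₁< sq≤i in
         i , ℕ.<⇒≤ q<i , trans (cong (_ ∪_) S≡) (choose-step i q (≢-sym (Fin.<⇒≢ q<i))))
      j (sound a)
  sound (acc-hi {fill i p} {S} a) =
    following-elim (λ q r → Spec r S → Spec (node (fill i q)) (⁅ q ↑ˡ M ⁆ ∪ S))
      (λ _ p → node (fill i p)) (λ _ → node (mark i))
      (λ S≡ → trans (cong (_ ∪_) S≡) (fill-last-step i))
      (λ q S≡ → trans (cong (_ ∪_) S≡) (fill-step i q))
      p (sound a)
  sound (acc-hi {mark i} a) rewrite sound a = ⁅↑ʳ⁆∪∅ M i

  mark-accepts : ∀ i → Accepts diagram (node (mark i)) (∅ {M} ++ ⁅ i ⁆)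
  mark-accepts i = subst (Accepts diagram (node (mark i))) (⁅↑ʳ⁆∪∅ M i) (acc-hi acc-top)

  fill-accepts : ∀ i p → Accepts diagram (node (fill i p)) (Up p ++ ⁅ i ⁆)
  fill-accepts i = >-weakInduction (λ p → Accepts diagram (node (fill i p)) (Up p ++ ⁅ i ⁆))
    (subst (Accepts diagram (node (fill i (fromℕ m)))) (fill-last-step i)
      (acc-hi (subst (λ r → Accepts diagram r (∅ {M} ++ ⁅ i ⁆)) (sym (following-fromℕ next end))
                     (mark-accepts i))))
    (λ q IH → subst (Accepts diagram (node (fill i (inject₁ q)))) (fill-step i q)
      (acc-hi (subst (λ r → Accepts diagram r (Up (Fin.suc q) ++ ⁅ i ⁆))
                     (sym (following-inject₁ next end q)) IH)))
    where
    next = λ p → node (fill i p)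
    end  = node (mark i)

  choose-at : ∀ i → Accepts diagram (node (choose i)) ((Up i - i) ++ ⁅ i ⁆)
  choose-at i = acc-lo (following-elim (λ q r → Accepts diagram r ((Up q - q) ++ ⁅ q ⁆))
    (λ j p → node (fill j p)) (λ j → node (mark j))
    (subst (λ X → Accepts diagram (node (mark (fromℕ m))) (X ++ ⁅ fromℕ m ⁆))
           (sym (Up-fromℕ-self m)) (mark-accepts (fromℕ m)))
    (λ q → subst (λ X → Accepts diagram (node (fill (inject₁ q) (Fin.suc q))) (X ++ ⁅ inject₁ q ⁆))
                 (sym (Up-inject₁-self q)) (fill-accepts (inject₁ q) (Fin.suc q)))
    i)

  choose-accepts : ∀ i j → j Fin.≤ i → Accepts diagram (node (choose j)) ((Up j - i) ++ ⁅ i ⁆)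
  choose-accepts i = >-weakInduction P
    (λ m≤i → subst (λ j → Accepts diagram (node (choose j)) ((Up j - i) ++ ⁅ i ⁆))
                   (Fin.≤-antisym (Fin.≤fromℕ i) m≤i) (choose-at i))
    step
    where
    P : Fin M → Set
    P j = j Fin.≤ i → Accepts diagram (node (choose j)) ((Up j - i) ++ ⁅ i ⁆)
    step : ∀ q → P (Fin.suc q) → P (inject₁ q)
    step q IH q≤i with inject₁ q Fin.≟ i
    ... | yes refl = choose-at _
    ... | no  q≢i  = subst (Accepts diagram (node (choose (inject₁ q)))) (choose-step i q (≢-sym q≢i))
      (acc-hi (subst (λ r → Accepts diagram r ((Up (Fin.suc q) - i) ++ ⁅ i ⁆))
                     (sym (following-inject₁ (λ j → node (choose j)) bot q))
                     (IH (inject₁<⇒suc≤ (Fin.≤∧≢⇒< q≤i q≢i)))))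

coPairs-zsize : ∀ m → ZSize≤ (CoPairs (suc m)) (suc m + (suc m * suc m + suc m) + 2)
coPairs-zsize m = diagram-zsize (↔-sym k↔Node) diagram λ S →
  mk⇔ (λ a → root-sound (sound a))
      (λ (i , S≡) → subst (Accepts diagram _) (trans (cong (_++ ⁅ i ⁆) (⊤─p≡∁p ⁅ i ⁆)) (sym S≡))
                          (choose-accepts i Fin.zero z≤n))
  where
  open CoPairsDiagram m
  k↔Node : Fin (M + (M * M + M)) ↔ Node
  k↔Node = ↔-trans Fin.+↔⊎ (↔-refl ⊎-↔ ↔-trans Fin.+↔⊎ (Fin.*↔× ⊎-↔ ↔-refl))
  root-sound : ∀ {S} → Spec (node (choose Fin.zero)) S → CoPairs M S
  root-sound (i , _ , S≡) = i , trans S≡ (cong (_++ ⁅ i ⁆) (⊤─p≡∁p ⁅ i ⁆))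

-- Separation by singletons

separating-by-singletons : ∀ {m} (H : Family (m + m)) →
  (∀ {x x′ : Subset m} {i} → i ∈ x → i ∉ x′ → ¬ (H (x ++ ⁅ i ⁆) ⇔ H (x′ ++ ⁅ i ⁆))) →
  Separating {m} H
separating-by-singletons _ separates x≢x′ with ≢⇒∃∈∉ x≢x′
... | i , inj₁ (i∈x , i∉x′) = ⁅ i ⁆ , separates i∈x i∉x′
... | i , inj₂ (i∈x′ , i∉x) = ⁅ i ⁆ , separates i∈x′ i∉x ∘ ⇔.sym

pairs-below : ∀ {m} {x : Subset m} {i} → i ∈ x → ∃ λ T → Pairs m T × T ⊆ x ++ ⁅ i ⁆
pairs-below {i = i} i∈x = ⁅ i ⁆ ++ ⁅ i ⁆ , (i , refl) , ++-⊆⁺ (⁅x⁆⊆ i∈x) ⊆-refl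

pairs-not-below : ∀ {m} {x : Subset m} {i} → i ∉ x → ∀ T → Pairs m T → ¬ T ⊆ x ++ ⁅ i ⁆
pairs-not-below {x = x} {i} i∉x _ (j , refl) ⊆′
  with ⁅x⁆⊆⁅y⁆⇒x≡y {x = j} {i} (++-⊆⁻ʳ {u = ⁅ j ⁆} {x} ⊆′)
... | refl = i∉x (++-⊆⁻ˡ {v = ⁅ j ⁆} {⁅ j ⁆} ⊆′ (x∈⁅x⁆ j))

coPairs-above : ∀ {m} {x : Subset m} {i} → i ∉ x → ∃ λ T → CoPairs m T × x ++ ⁅ i ⁆ ⊆ T
coPairs-above {x = x} {i} i∉x = ∁ ⁅ i ⁆ ++ ⁅ i ⁆ , (i , refl) , ++-⊆⁺ {u = x} x⊆∁⁅i⁆ ⊆-refl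
  where
  x⊆∁⁅i⁆ : x ⊆ ∁ ⁅ i ⁆
  x⊆∁⁅i⁆ a∈x = x∉p⇒x∈∁p (x≢y⇒x∉⁅y⁆ λ { refl → i∉x a∈x })

coPairs-not-above : ∀ {m} {x : Subset m} {i} → i ∈ x → ∀ T → CoPairs m T → ¬ x ++ ⁅ i ⁆ ⊆ T
coPairs-not-above {x = x} {i} i∈x _ (j , refl) ⊆′
  with ⁅x⁆⊆⁅y⁆⇒x≡y {x = i} {j} (++-⊆⁻ʳ {u = x} {∁ ⁅ j ⁆} ⊆′)
... | refl = x∈∁p⇒x∉p (++-⊆⁻ˡ {v = ⁅ i ⁆} {⁅ i ⁆} ⊆′ i∈x) (x∈⁅x⁆ i)

Witness : Op → ∀ m → Family (m + m)
Witness restrict    = Pairs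
Witness nonsuperset = Pairs
Witness permit      = CoPairs
Witness nonsubset   = CoPairs

¬⇔-left : ∀ {A B : Set} → A → ¬ B → ¬ (A ⇔ B)
¬⇔-left a ¬b A⇔B = ¬b (Equivalence.to A⇔B a)

¬⇔-right : ∀ {A B : Set} → ¬ A → B → ¬ (A ⇔ B)
¬⇔-right ¬a b A⇔B = ¬a (Equivalence.from A⇔B b)

witness-separating : ∀ op m → Separating {m} (apply op Everything (Witness op m))
witness-separating restrict m =
  separating-by-singletons {m} (apply restrict Everything (Pairs m)) λ i∈x i∉x′ →
    ¬⇔-left (tt , pairs-below i∈x) (λ (_ , T , T∈G , T⊆) → pairs-not-below i∉x′ T T∈G T⊆)
witness-separating nonsuperset m =
  separating-by-singletons {m} (apply nonsuperset Everything (Pairs m)) λ i∈x i∉x′ →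
    ¬⇔-right (λ (_ , none⊆) → let T , T∈G , T⊆ = pairs-below i∈x in none⊆ T T∈G T⊆)
             (tt , pairs-not-below i∉x′)
witness-separating permit m =
  separating-by-singletons {m} (apply permit Everything (CoPairs m)) λ i∈x i∉x′ →
    ¬⇔-right (λ (_ , T , T∈G , ⊆T) → coPairs-not-above i∈x T T∈G ⊆T) (tt , coPairs-above i∉x′)
witness-separating nonsubset m =
  separating-by-singletons {m} (apply nonsubset Everything (CoPairs m)) λ i∈x i∉x′ →
    ¬⇔-left (tt , coPairs-not-above i∈x)
            (λ (_ , none⊆) → let T , T∈G , ⊆T = coPairs-above i∉x′ in none⊆ T T∈G ⊆T)

witness-zsize : ∀ op m → ZSize≤ (Witness op (suc m)) (suc m + (suc m * suc m + suc m) + 2)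
witness-zsize restrict    m = zsize-weaken (pairs-zsize m) (pairs≤coPairs (suc m))
  where
  pairs≤coPairs : ∀ a → a + a + 2 ≤ a + (a * a + a) + 2
  pairs≤coPairs a = ℕ.+-monoˡ-≤ 2 (ℕ.+-monoʳ-≤ a (ℕ.m≤n+m a (a * a)))
witness-zsize nonsuperset m = witness-zsize restrict m
witness-zsize permit      m = coPairs-zsize m
witness-zsize nonsubset   m = coPairs-zsize m

square-bound : ∀ a → 1 ≤ a → (a + 2) * (a + 2) ≤ 9 * a ^ 2
square-bound a 1≤a = begin
  (a + 2) * (a + 2)   ≤⟨ ℕ.*-mono-≤ a+2≤3a a+2≤3a ⟩
  (3 * a) * (3 * a)   ≡⟨ 3a-squared a ⟩
  9 * (a * a)         ≡⟨ cong (λ x → 9 * (a * x)) (ℕ.*-identityʳ a) ⟨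
  9 * a ^ 2           ∎
  where
  open ℕ.≤-Reasoning
  a+2≤3a : a + 2 ≤ 3 * a
  a+2≤3a = ℕ.+-monoʳ-≤ a (ℕ.*-monoʳ-≤ 2 1≤a)
  3a-squared : ∀ a → (3 * a) * (3 * a) ≡ 9 * (a * a)
  3a-squared = solve-∀

ground-bound : ∀ a → 1 ≤ a → a + a ≤ 9 * a ^ 2
ground-bound a 1≤a = begin
  a + a                                   ≤⟨ ℕ.m≤m+n (a + a) _ ⟩
  (a + a) + (a * a + (a + a) + 4)         ≡⟨ expand a ⟨
  (a + 2) * (a + 2)                       ≤⟨ square-bound a 1≤a ⟩
  9 * a ^ 2                               ∎
  where
  open ℕ.≤-Reasoning
  expand : ∀ a → (a + 2) * (a + 2) ≡ (a + a) + (a * a + (a + a) + 4)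
  expand = solve-∀

nodes-bound : ∀ a → 1 ≤ a → (a + a + 2) + (a + (a * a + a) + 2) ≤ 9 * a ^ 4
nodes-bound a@(suc _) 1≤a = begin
  (a + a + 2) + (a + (a * a + a) + 2)   ≡⟨ collect a ⟩
  (a + 2) * (a + 2)                     ≤⟨ square-bound a 1≤a ⟩
  9 * a ^ 2                             ≤⟨ ℕ.*-monoʳ-≤ 9 (ℕ.^-monoʳ-≤ a {2} {4} (s≤s (s≤s z≤n))) ⟩
  9 * a ^ 4                             ∎
  where
  open ℕ.≤-Reasoning
  collect : ∀ a → (a + a + 2) + (a + (a * a + a) + 2) ≡ (a + 2) * (a + 2)
  collect = solve-∀

theorem10 : (op : Op) →
    Σ ℕ λ C → Σ ℕ λ c → Σ ℕ λ d → Σ ℕ λ M →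
      (m : ℕ) → 1 ≤ m →
        Σ ℕ λ n → (n ≤ C * m ^ 2) ×
        Σ (Family n) λ F → Σ (Family n) λ G →
          (Σ ℕ λ a → Σ ℕ λ b → ZSize≤ F a × ZSize≤ G b × (a + b ≤ C * m ^ 4))
          × (M ≤ m → ∀ k (Z : ZDD n k) → Represents Z (apply op F G) →
               2 ^ m ≤ c * m ^ d * size Z)
theorem10 op = 9 , 1 , 0 , 0 , λ where
  (suc m) 1≤m →
    suc m + suc m , ground-bound (suc m) 1≤m , Everything , Witness op (suc m) ,
    (_ , _ , everything-zsize (m + suc m) , witness-zsize op m , nodes-bound (suc m) 1≤m) ,
    λ _ k Z Z-rep → subst (2 ^ suc m ≤_) (sym (ℕ.*-identityˡ (size Z)))
                      (separating⇒2^p≤size Z Z-rep (witness-separating op (suc m)))
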